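{- Let $k\in\mathbb{N}$ and let $G$ be a $k$-tree. Then there exists a proper vertex coloring $c:V(G)\to\{1,2,\ldots,k+2\}$ such that for every vertex $v\in V(G)$ with $\deg_G(v)\geq k+1$, the closed neighborhood $N_G[v]$ contains vertices of all $k+2$ colors.
   Context: All graphs are simple and finite. For $k\in\mathbb{N}$, a $k$-tree is defined recursively: the complete graph $K_{k+1}$ is a $k$-tree, and if $G$ is a $k$-tree then the graph obtained by adding a new vertex and joining it to all vertices of some $k$-clique (complete subgraph on $k$ vertices) of $G$ is a $k$-tree. A proper coloring assigns colors to vertices so that adjacent vertices receive different colors. $N_G[v]=\{v\}\cup\{u: uv\in E(G)\}$ is the closed neighborhood of $v$. -}

module Defs where

open import Data.Nat using (ℕ; suc; _≤_; _+_)
open import Data.Fin using (Fin; inject₁; fromℕ)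
open import Data.Bool using (Bool; true; false; T)
import Data.Bool as Bool
open import Data.Sum using (_⊎_)
open import Data.List using (List; length; filter; allFin)
open import Data.List.Membership.Propositional using (_∈_)
open import Data.List.Relation.Unary.Unique.Propositional using (Unique)
open import Data.Product using (Σ; ∃; _×_; _,_)
open import Relation.Binary.PropositionalEquality using (_≡_; _≢_)
open import Relation.Nullary using (¬_)
open import Function.Bundles using (_⇔_)

-- A finite simple graph on vertex set Fin n, given by a Bool-valued adjacency
-- relation (symmetry / irreflexivity are guaranteed by the k-tree construction
-- below).
Graph : ℕ → Set
Graph n = Fin n → Fin n → Bool

Adj : ∀ {n} → Graph n → Fin n → Fin n → Set
Adj G u v = T (G u v)

IsClique : ∀ {n} → Graph n → List (Fin n) → Set
IsClique G C = Unique C × (∀ u v → u ∈ C → v ∈ C → u ≢ v → Adj G u v)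

IsKClique : ∀ {n} → ℕ → Graph n → List (Fin n) → Set
IsKClique k G C = length C ≡ k × IsClique G C

-- Adjacency is specified pointwise (via ⇔), so any graph with the right edge
-- set qualifies.
data KTree (k : ℕ) : (n : ℕ) → Graph n → Set where
  base : (G : Graph (suc k)) →
         (∀ u v → Adj G u v ⇔ (u ≢ v)) →
         KTree k (suc k) G
  step : ∀ {n} {G : Graph n} → KTree k n G →
         (C : List (Fin n)) → IsKClique k G C →
         (G' : Graph (suc n)) →
         (∀ u v → Adj G' (inject₁ u) (inject₁ v) ⇔ Adj G u v) →
         (∀ u → Adj G' (fromℕ n) (inject₁ u) ⇔ (u ∈ C)) →
         (∀ u → Adj G' (inject₁ u) (fromℕ n) ⇔ (u ∈ C)) →
         ¬ Adj G' (fromℕ n) (fromℕ n) →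
         KTree k (suc n) G'

deg : ∀ {n} → Graph n → Fin n → ℕ
deg {n} G v = length (filter (λ u → Bool._≟_ (G v u) true) (allFin n))

InClosedNbhd : ∀ {n} → Graph n → Fin n → Fin n → Set
InClosedNbhd G v u = (u ≡ v) ⊎ Adj G v u

ProperColoring : ∀ {n m} → Graph n → (Fin n → Fin m) → Set
ProperColoring G c = ∀ u v → Adj G u v → c u ≢ c v

-- Induct along the construction of the k-tree, maintaining a stronger invariant: every
-- vertex is either rainbow (its closed neighbourhood sees all k + 2 colours) or defective,
-- meaning it has at most k neighbours and its closed neighbourhood sees every colour but
-- one, its defect; adjacent defective vertices have the same defect. When a vertex x is
-- attached to a k-clique C, colour x with the common defect of the defective vertices of C
-- if there are any (it is absent from C, which lies in their closed neighbourhoods), and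
-- otherwise with any colour unused on C. Every vertex of C then becomes rainbow, and x is
-- defective, its defect being the one colour missing from the k + 1 distinct colours on
-- C ∪ {x}. A vertex of degree at least k + 1 cannot be defective, so it is rainbow.
module Submission where

open import Defs
open import Data.Nat using (ℕ; zero; suc; _≤_; _<_; s≤s; z≤n)
open import Data.Nat.Properties using (n≤1+n; n≮n; ≤⇒≯; ≤-trans; ≤-reflexive; module ≤-Reasoning)
open import Data.Fin using (Fin; zero; suc; inject₁; fromℕ; punchIn; _≟_)
open import Data.Fin.Properties using (fromℕ≢inject₁; inject₁-injective; punchIn-punchOut; ¬∀⟶∃¬)
open import Data.Bool using (true; T)
import Data.Bool as Bool
open import Data.Unit using (tt)
open import Data.Maybe using (Maybe; just; nothing)
open import Data.Maybe.Properties using (just-injective)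
open import Data.Sum using (_⊎_; inj₁; inj₂)
open import Data.Product using (Σ; _×_; ∃; ∃₂; _,_; proj₁; proj₂)
open import Data.List using (List; []; _∷_; length; map; filter; allFin)
open import Data.List.Properties using (length-map; length-tabulate; length-removeAt′)
open import Data.List.Membership.Propositional using (_∈_; _∉_; _─_)
open import Data.List.Membership.Propositional.Properties using (∈-map⁺; ∈-map⁻; ∈-filter⁻; ∈-allFin)
open import Data.List.Relation.Binary.Subset.Propositional using (_⊆_)
open import Data.List.Relation.Unary.Any using (here; there; index)
import Data.List.Relation.Unary.All as All
import Data.List.Relation.Unary.All.Properties as All
open import Data.List.Relation.Unary.Unique.Propositional using (Unique; []; _∷_)
import Data.List.Relation.Unary.Unique.Propositional.Properties as Unique
open import Relation.Binary.PropositionalEquality using (_≡_; _≢_; refl; sym; trans; cong; subst; ≢-sym)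
open import Relation.Nullary using (¬_; Dec; yes; no; contradiction)
open import Function.Bundles using (_⇔_; Equivalence)
open Equivalence using (to; from)

module _ {n : ℕ} where
  open import Data.List.Membership.DecPropositional (_≟_ {n}) using (_∈?_) public

module _ {a} {A : Set a} where

  ∈-─ : ∀ {x y : A} {ys} (x∈ys : x ∈ ys) → y ∈ ys → y ≢ x → y ∈ ys ─ x∈ys
  ∈-─ (here refl)  (here refl)  y≢x = contradiction refl y≢x
  ∈-─ (here refl)  (there y∈ys) _   = y∈ys
  ∈-─ (there _)    (here refl)  _   = here refl
  ∈-─ (there x∈ys) (there y∈ys) y≢x = there (∈-─ x∈ys y∈ys y≢x)

  Unique⇒length≤ : ∀ {xs ys : List A} → Unique xs → xs ⊆ ys → length xs ≤ length ys
  Unique⇒length≤ {[]}     _               _     = z≤n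
  Unique⇒length≤ {x ∷ xs} {ys} (x∉xs ∷ xs!) xs⊆ys = begin
    suc (length xs)          ≤⟨ s≤s (Unique⇒length≤ xs! xs⊆ys─x) ⟩
    suc (length (ys ─ x∈ys)) ≡⟨ sym (length-removeAt′ ys (index x∈ys)) ⟩
    length ys                ∎
    where
    open ≤-Reasoning
    x∈ys : x ∈ ys
    x∈ys = xs⊆ys (here refl)
    xs⊆ys─x : xs ⊆ ys ─ x∈ys
    xs⊆ys─x y∈xs = ∈-─ x∈ys (xs⊆ys (there y∈xs)) (≢-sym (All.lookup x∉xs y∈xs))

  Unique-map⁺ : ∀ {b} {B : Set b} (f : A → B) {xs} → Unique xs →
                (∀ {x y} → x ∈ xs → y ∈ xs → x ≢ y → f x ≢ f y) → Unique (map f xs)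
  Unique-map⁺ f {[]}     []           _   = []
  Unique-map⁺ f {x ∷ xs} (x∉xs ∷ xs!) sep =
    All.map⁺ (All.tabulate λ y∈xs → sep (here refl) (there y∈xs) (All.lookup x∉xs y∈xs))
    ∷ Unique-map⁺ f xs! (λ x∈xs y∈xs → sep (there x∈xs) (there y∈xs))

length-allFin : ∀ m → length (allFin m) ≡ m
length-allFin m = length-tabulate (λ i → i)

∃∉ : ∀ {m} (xs : List (Fin m)) → length xs < m → ∃ (_∉ xs)
∃∉ {m} xs |xs|<m = ¬∀⟶∃¬ m (_∈ xs) (_∈? xs) λ all∈xs → ≤⇒≯ (m≤|xs| all∈xs) |xs|<m
  where
  m≤|xs| : (∀ i → i ∈ xs) → m ≤ length xs
  m≤|xs| all∈xs = subst (_≤ length xs) (length-allFin m)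
                        (Unique⇒length≤ (Unique.allFin⁺ m) (λ {i} _ → all∈xs i))

allFinExcept : ∀ {m} → Fin (suc m) → List (Fin (suc m))
allFinExcept {m} b = map (punchIn b) (allFin m)

length-allFinExcept : ∀ {m} (b : Fin (suc m)) → length (allFinExcept b) ≡ m
length-allFinExcept {m} b = trans (length-map (punchIn b) (allFin m)) (length-allFin m)

∈-allFinExcept : ∀ {m} {a b : Fin (suc m)} → a ≢ b → a ∈ allFinExcept b
∈-allFinExcept a≢b = subst (_∈ _) (punchIn-punchOut (≢-sym a≢b)) (∈-map⁺ _ (∈-allFin _))

∃!∉ : ∀ {m} (xs : List (Fin (suc m))) → Unique xs → length xs ≡ m →
      ∃ λ b → b ∉ xs × (∀ a → a ≢ b → a ∈ xs)
∃!∉ {m} xs xs! |xs|≡m with ∃∉ xs (s≤s (≤-reflexive |xs|≡m))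
... | b , b∉xs = b , b∉xs , others∈xs
  where
  others∈xs : ∀ a → a ≢ b → a ∈ xs
  others∈xs a a≢b with a ∈? xs
  ... | yes a∈xs = a∈xs
  ... | no  a∉xs = contradiction too-long (n≮n m)
    where
    a∷xs⊆ : a ∷ xs ⊆ allFinExcept b
    a∷xs⊆ (here refl)  = ∈-allFinExcept a≢b
    a∷xs⊆ (there z∈xs) = ∈-allFinExcept λ z≡b → b∉xs (subst (_∈ xs) z≡b z∈xs)
    too-long : suc m ≤ m
    too-long = begin
      suc m                   ≡⟨ cong suc (sym |xs|≡m) ⟩
      length (a ∷ xs)         ≤⟨ Unique⇒length≤ (All.¬Any⇒All¬ xs a∉xs ∷ xs!) a∷xs⊆ ⟩
      length (allFinExcept b) ≡⟨ length-allFinExcept b ⟩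
      m                       ∎
      where open ≤-Reasoning

data LastView : ∀ {n} → Fin (suc n) → Set where
  old : ∀ {n} (u : Fin n) → LastView (inject₁ u)
  new : ∀ {n} → LastView (fromℕ n)

lastView : ∀ {n} (i : Fin (suc n)) → LastView i
lastView {zero}  zero    = new
lastView {suc n} zero    = old zero
lastView {suc n} (suc i) with lastView i
... | old u = old (suc u)
... | new   = new

extend : ∀ {n} {A : Set} → (Fin n → A) → A → Fin (suc n) → A
extend {zero}  f a _       = a
extend {suc n} f a zero    = f zero
extend {suc n} f a (suc i) = extend (λ j → f (suc j)) a i

extend-inject₁ : ∀ {n} {A : Set} (f : Fin n → A) a u → extend f a (inject₁ u) ≡ f u
extend-inject₁ {suc n} f a zero    = refl
extend-inject₁ {suc n} f a (suc u) = extend-inject₁ (λ j → f (suc j)) a u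

extend-fromℕ : ∀ {n} {A : Set} (f : Fin n → A) a → extend f a (fromℕ n) ≡ a
extend-fromℕ {zero}  f a = refl
extend-fromℕ {suc n} f a = extend-fromℕ (λ j → f (suc j)) a

deg≤length : ∀ {n} (G : Graph n) v {xs : List (Fin n)} → (∀ {u} → Adj G v u → u ∈ xs) →
             deg G v ≤ length xs
deg≤length {n} G v adj⇒∈ = Unique⇒length≤ (Unique.filter⁺ adj? (Unique.allFin⁺ n)) nbrs⊆
  where
  adj? : ∀ u → Dec (G v u ≡ true)
  adj? u = Bool._≟_ (G v u) true
  nbrs⊆ : filter adj? (allFin n) ⊆ _
  nbrs⊆ u∈ = adj⇒∈ (subst T (sym (proj₂ (∈-filter⁻ adj? {xs = allFin n} u∈))) tt)

Covers : ∀ {n m} → Graph n → (Fin n → Fin m) → Fin n → Fin m → Set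
Covers {n} G c v a = Σ (Fin n) λ u → InClosedNbhd G v u × c u ≡ a

Rainbow : ∀ {n m} → Graph n → (Fin n → Fin m) → Fin n → Set
Rainbow G c v = ∀ a → Covers G c v a

record Defective {n m} (k : ℕ) (G : Graph n) (c : Fin n → Fin m) (v : Fin n) (a : Fin m) : Set where
  field
    nbrs        : List (Fin n)
    length-nbrs : length nbrs ≤ k
    adj⇒∈nbrs   : ∀ {u} → Adj G v u → u ∈ nbrs
    covers      : ∀ b → b ≢ a → Covers G c v b
    avoids      : ∀ {u} → InClosedNbhd G v u → c u ≢ a

Defective⇒deg≤ : ∀ {n m k} {G : Graph n} {c : Fin n → Fin m} {v a} → Defective k G c v a → deg G v ≤ k
Defective⇒deg≤ {G = G} {v = v} D = ≤-trans (deg≤length G v adj⇒∈nbrs) length-nbrs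
  where open Defective D

Colour : ℕ → Set
Colour k = Fin (suc (suc k))

record DefectColouring (k : ℕ) {n} (G : Graph n) : Set where
  field
    colour       : Fin n → Colour k
    proper       : ProperColoring G colour
    defect       : Fin n → Maybe (Colour k)
    rainbow      : ∀ {v} → defect v ≡ nothing → Rainbow G colour v
    defective    : ∀ {v a} → defect v ≡ just a → Defective k G colour v a
    defect-agree : ∀ {u v a b} → Adj G u v → defect u ≡ just a → defect v ≡ just b → a ≡ b

complete-defectColouring : ∀ k (G : Graph (suc k)) → (∀ u v → Adj G u v ⇔ (u ≢ v)) →
                           DefectColouring k G
complete-defectColouring k G adj⇔≢ = record
  { colour       = inject₁
  ; proper       = λ u v adj cu≡cv → to (adj⇔≢ u v) adj (inject₁-injective cu≡cv)
  ; defect       = λ _ → just (fromℕ (suc k))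
  ; rainbow      = λ ()
  ; defective    = λ { refl → defective }
  ; defect-agree = λ { _ refl refl → refl }
  }
  where
  defective : ∀ {v} → Defective k G inject₁ v (fromℕ (suc k))
  defective {v} = record
    { nbrs        = allFinExcept v
    ; length-nbrs = ≤-reflexive (length-allFinExcept v)
    ; adj⇒∈nbrs   = λ {u} adj → ∈-allFinExcept (≢-sym (to (adj⇔≢ v u) adj))
    ; covers      = covers
    ; avoids      = λ _ e → fromℕ≢inject₁ (sym e)
    }
    where
    covers : ∀ b → b ≢ fromℕ (suc k) → Covers G inject₁ v b
    covers b b≢last with lastView b
    ... | new = contradiction refl b≢last
    ... | old u with u ≟ v
    ...   | yes u≡v = u , inj₁ u≡v , refl
    ...   | no  u≢v = u , inj₂ (from (adj⇔≢ v u) (≢-sym u≢v)) , refl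

module Attach {k n} {G : Graph n} (I : DefectColouring k G) (C : List (Fin n)) (Ck : IsKClique k G C)
  (G' : Graph (suc n))
  (old-adj : ∀ u v → Adj G' (inject₁ u) (inject₁ v) ⇔ Adj G u v)
  (new-adj : ∀ u → Adj G' (fromℕ n) (inject₁ u) ⇔ (u ∈ C))
  (adj-new : ∀ u → Adj G' (inject₁ u) (fromℕ n) ⇔ (u ∈ C))
  (new-irrefl : ¬ Adj G' (fromℕ n) (fromℕ n)) where

  open DefectColouring I

  |C|≡k : length C ≡ k
  |C|≡k = proj₁ Ck

  C! : Unique C
  C! = proj₁ (proj₂ Ck)

  |colour-C|≡k : length (map colour C) ≡ k
  |colour-C|≡k = trans (length-map colour C) |C|≡k

  C-clique : ∀ {u v} → u ∈ C → v ∈ C → u ≢ v → Adj G u v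
  C-clique = proj₂ (proj₂ Ck) _ _

  C⊆nbhd : ∀ {u w} → u ∈ C → w ∈ C → InClosedNbhd G u w
  C⊆nbhd {u} {w} u∈C w∈C with w ≟ u
  ... | yes w≡u = inj₁ w≡u
  ... | no  w≢u = inj₂ (C-clique u∈C w∈C (≢-sym w≢u))

  defective-in? : (xs : List (Fin n)) →
                  (∃₂ λ u a → u ∈ xs × defect u ≡ just a) ⊎ (∀ {u} → u ∈ xs → defect u ≡ nothing)
  defective-in? [] = inj₂ λ ()
  defective-in? (u ∷ xs) with defect u in du
  ... | just a  = inj₁ (u , a , here refl , du)
  ... | nothing with defective-in? xs
  ...   | inj₁ (w , a , w∈xs , dw) = inj₁ (w , a , there w∈xs , dw)
  ...   | inj₂ none = inj₂ λ { (here refl) → du ; (there w∈xs) → none w∈xs }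

  NewColour : Colour k → Set
  NewColour a₀ = (∀ {w} → w ∈ C → colour w ≢ a₀) × (∀ {v a} → v ∈ C → defect v ≡ just a → a ≡ a₀)

  newColour : ∃ NewColour
  newColour with defective-in? C
  ... | inj₁ (u , a , u∈C , du) = a , (λ w∈C → avoids (C⊆nbhd u∈C w∈C)) , agree
    where
    open Defective (defective du)
    agree : ∀ {v a'} → v ∈ C → defect v ≡ just a' → a' ≡ a
    agree {v} v∈C dv with v ≟ u
    ... | yes refl = just-injective (trans (sym dv) du)
    ... | no  v≢u  = defect-agree (C-clique v∈C u∈C v≢u) dv du
  ... | inj₂ none with ∃∉ (map colour C) (s≤s (≤-trans (≤-reflexive |colour-C|≡k) (n≤1+n k)))
  ...   | b , b∉ = b , (λ w∈C cw≡b → b∉ (subst (_∈ _) cw≡b (∈-map⁺ colour w∈C)))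
                     , λ v∈C dv → contradiction (trans (sym (none v∈C)) dv) λ ()

  a₀ : Colour k
  a₀ = proj₁ newColour

  a₀∉colour-C : ∀ {w} → w ∈ C → colour w ≢ a₀
  a₀∉colour-C = proj₁ (proj₂ newColour)

  defect-C≡a₀ : ∀ {v a} → v ∈ C → defect v ≡ just a → a ≡ a₀
  defect-C≡a₀ = proj₂ (proj₂ newColour)

  used : List (Colour k)
  used = a₀ ∷ map colour C

  used! : Unique used
  used! = All.tabulate a₀∉ ∷ Unique-map⁺ colour C! λ u∈C v∈C u≢v → proper _ _ (C-clique u∈C v∈C u≢v)
    where
    a₀∉ : ∀ {a} → a ∈ map colour C → a₀ ≢ a
    a₀∉ a∈ with ∈-map⁻ colour a∈
    ... | w , w∈C , refl = ≢-sym (a₀∉colour-C w∈C)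

  missing : ∃ λ b → b ∉ used × (∀ a → a ≢ b → a ∈ used)
  missing = ∃!∉ used used! (cong suc |colour-C|≡k)

  b : Colour k
  b = proj₁ missing

  colour' : Fin (suc n) → Colour k
  colour' = extend colour a₀

  colour'-old : ∀ u → colour' (inject₁ u) ≡ colour u
  colour'-old = extend-inject₁ colour a₀

  colour'-new : colour' (fromℕ n) ≡ a₀
  colour'-new = extend-fromℕ colour a₀

  defect-off-C : Fin n → Maybe (Colour k)
  defect-off-C v with v ∈? C
  ... | yes _ = nothing
  ... | no  _ = defect v

  defect-off-C-just : ∀ {v a} → defect-off-C v ≡ just a → v ∉ C × defect v ≡ just a
  defect-off-C-just {v} dv with v ∈? C
  defect-off-C-just () | yes _
  defect-off-C-just dv | no v∉C = v∉C , dv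

  defect-off-C-∉ : ∀ {v} → v ∉ C → defect-off-C v ≡ defect v
  defect-off-C-∉ {v} v∉C with v ∈? C
  ... | yes v∈C = contradiction v∈C v∉C
  ... | no  _   = refl

  defect' : Fin (suc n) → Maybe (Colour k)
  defect' = extend defect-off-C (just b)

  defect'-old : ∀ {v a} → defect' (inject₁ v) ≡ just a → v ∉ C × defect v ≡ just a
  defect'-old {v} dv = defect-off-C-just (trans (sym (extend-inject₁ defect-off-C (just b) v)) dv)

  defect'-new : defect' (fromℕ n) ≡ just b
  defect'-new = extend-fromℕ defect-off-C (just b)

  nbhd-old⁺ : ∀ {v u} → InClosedNbhd G v u → InClosedNbhd G' (inject₁ v) (inject₁ u)
  nbhd-old⁺ (inj₁ u≡v) = inj₁ (cong inject₁ u≡v)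
  nbhd-old⁺ (inj₂ adj) = inj₂ (from (old-adj _ _) adj)

  nbhd-old⁻ : ∀ {v u} → InClosedNbhd G' (inject₁ v) (inject₁ u) → InClosedNbhd G v u
  nbhd-old⁻ (inj₁ u≡v) = inj₁ (inject₁-injective u≡v)
  nbhd-old⁻ (inj₂ adj) = inj₂ (to (old-adj _ _) adj)

  covers-old : ∀ {v a} → Covers G colour v a → Covers G' colour' (inject₁ v) a
  covers-old (u , u∈N , cu≡a) = inject₁ u , nbhd-old⁺ u∈N , trans (colour'-old u) cu≡a

  rainbow-C : ∀ {v} → v ∈ C → Rainbow G' colour' (inject₁ v)
  rainbow-C {v} v∈C a with a ≟ a₀
  ... | yes refl = fromℕ n , inj₂ (from (adj-new v) v∈C) , colour'-new
  ... | no  a≢a₀ with defect v in dv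
  ...   | nothing = covers-old (rainbow dv a)
  ...   | just d  = covers-old (Defective.covers (defective dv) a λ a≡d →
                                a≢a₀ (trans a≡d (defect-C≡a₀ v∈C dv)))

  proper' : ProperColoring G' colour'
  proper' u' v' adj with lastView u' | lastView v'
  ... | old u | old v rewrite colour'-old u | colour'-old v = proper u v (to (old-adj u v) adj)
  ... | old u | new   rewrite colour'-old u | colour'-new   = a₀∉colour-C (to (adj-new u) adj)
  ... | new   | old v rewrite colour'-old v | colour'-new   = ≢-sym (a₀∉colour-C (to (new-adj v) adj))
  ... | new   | new   = contradiction adj new-irrefl

  rainbow' : ∀ {v'} → defect' v' ≡ nothing → Rainbow G' colour' v'
  rainbow' {v'} dv' with lastView v'
  ... | new = contradiction (trans (sym defect'-new) dv') λ ()
  ... | old v with v ∈? C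
  ...   | yes v∈C = rainbow-C v∈C
  ...   | no  v∉C = λ a → covers-old (rainbow dv a)
    where
    dv : defect v ≡ nothing
    dv = trans (sym (defect-off-C-∉ v∉C)) (trans (sym (extend-inject₁ defect-off-C (just b) v)) dv')

  defective-new : Defective k G' colour' (fromℕ n) b
  defective-new = record
    { nbrs        = map inject₁ C
    ; length-nbrs = ≤-reflexive (trans (length-map inject₁ C) |C|≡k)
    ; adj⇒∈nbrs   = adj⇒∈nbrs
    ; covers      = covers
    ; avoids      = avoids
    }
    where
    b∉used : b ∉ used
    b∉used = proj₁ (proj₂ missing)

    adj⇒∈nbrs : ∀ {u'} → Adj G' (fromℕ n) u' → u' ∈ map inject₁ C
    adj⇒∈nbrs {u'} adj with lastView u'
    ... | old u = ∈-map⁺ inject₁ (to (new-adj u) adj)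
    ... | new   = contradiction adj new-irrefl

    covers : ∀ a → a ≢ b → Covers G' colour' (fromℕ n) a
    covers a a≢b with proj₂ (proj₂ missing) a a≢b
    ... | here refl = fromℕ n , inj₁ refl , colour'-new
    ... | there a∈  with ∈-map⁻ colour a∈
    ...   | w , w∈C , refl = inject₁ w , inj₂ (from (new-adj w) w∈C) , colour'-old w

    avoids : ∀ {u'} → InClosedNbhd G' (fromℕ n) u' → colour' u' ≢ b
    avoids {u'} u'∈N with lastView u'
    avoids _          | new   = λ c≡b → b∉used (subst (_∈ used) (trans (sym colour'-new) c≡b) (here refl))
    avoids (inj₁ e)   | old u = contradiction (sym e) fromℕ≢inject₁
    avoids (inj₂ adj) | old u = λ c≡b → b∉used
      (subst (_∈ used) (trans (sym (colour'-old u)) c≡b) (there (∈-map⁺ colour (to (new-adj u) adj))))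

  defective-old : ∀ {v a} → v ∉ C → Defective k G colour v a → Defective k G' colour' (inject₁ v) a
  defective-old {v} {a} v∉C D = record
    { nbrs        = map inject₁ nbrs
    ; length-nbrs = subst (_≤ k) (sym (length-map inject₁ nbrs)) length-nbrs
    ; adj⇒∈nbrs   = adj⇒∈nbrs'
    ; covers      = λ d d≢a → covers-old (covers d d≢a)
    ; avoids      = avoids'
    }
    where
    open Defective D

    adj⇒∈nbrs' : ∀ {u'} → Adj G' (inject₁ v) u' → u' ∈ map inject₁ nbrs
    adj⇒∈nbrs' {u'} adj with lastView u'
    ... | old u = ∈-map⁺ inject₁ (adj⇒∈nbrs (to (old-adj v u) adj))
    ... | new   = contradiction (to (adj-new v) adj) v∉C

    avoids' : ∀ {u'} → InClosedNbhd G' (inject₁ v) u' → colour' u' ≢ a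
    avoids' {u'} u'∈N with lastView u'
    avoids' u∈N        | old u = λ c≡a → avoids (nbhd-old⁻ u∈N) (trans (sym (colour'-old u)) c≡a)
    avoids' (inj₁ e)   | new   = contradiction e fromℕ≢inject₁
    avoids' (inj₂ adj) | new   = contradiction (to (adj-new v) adj) v∉C

  defective' : ∀ {v' a} → defect' v' ≡ just a → Defective k G' colour' v' a
  defective' {v'} dv' with lastView v'
  ... | new with trans (sym defect'-new) dv'
  ...   | refl = defective-new
  defective' {v'} dv' | old v with defect'-old dv'
  ...   | v∉C , dv = defective-old v∉C (defective dv)

  defect-agree' : ∀ {u' v' a a'} → Adj G' u' v' → defect' u' ≡ just a → defect' v' ≡ just a' → a ≡ a'
  defect-agree' {u'} {v'} adj du' dv' with lastView u' | lastView v'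
  ... | old u | old v =
    defect-agree (to (old-adj u v) adj) (proj₂ (defect'-old du')) (proj₂ (defect'-old dv'))
  ... | old u | new   = contradiction (to (adj-new u) adj) (proj₁ (defect'-old du'))
  ... | new   | old v = contradiction (to (new-adj v) adj) (proj₁ (defect'-old dv'))
  ... | new   | new   = contradiction adj new-irrefl

  defectColouring : DefectColouring k G'
  defectColouring = record
    { colour = colour' ; proper = proper' ; defect = defect'
    ; rainbow = rainbow' ; defective = defective' ; defect-agree = defect-agree' }

KTree⇒DefectColouring : ∀ {k n G} → KTree k n G → DefectColouring k G
KTree⇒DefectColouring (base G adj⇔≢) = complete-defectColouring _ G adj⇔≢
KTree⇒DefectColouring (step t C Ck G' old-adj new-adj adj-new new-irrefl) =
  Attach.defectColouring (KTree⇒DefectColouring t) C Ck G' old-adj new-adj adj-new new-irrefl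

lemma1 : (k n : ℕ) (G : Graph n) → KTree k n G →
    Σ (Fin n → Fin (suc (suc k))) (λ c →
      ProperColoring G c ×
      ((v : Fin n) → suc k ≤ deg G v →
        (a : Fin (suc (suc k))) → Σ (Fin n) (λ u → InClosedNbhd G v u × c u ≡ a)))
lemma1 k n G t = colour , proper , high-degree⇒rainbow
  where
  open DefectColouring (KTree⇒DefectColouring t)
  high-degree⇒rainbow : ∀ v → suc k ≤ deg G v → Rainbow G colour v
  high-degree⇒rainbow v k<deg with defect v in dv
  ... | nothing = rainbow dv
  ... | just _  = contradiction k<deg (≤⇒≯ (Defective⇒deg≤ (defective dv)))
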